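{- For every multigraph $G$ and every $n\in\mathbb N$, $\left[\check P_{n/2},\Upsilon\vec D(G)\right]_{L}\cong\Upsilon\vec D\,\mathrm{Del}\left[P_{n},G\right]_{\beta}$.
   Context: $\check P_{n/2}$ is the incidence hypergraph "directed path of length $n/2$": an alternating sequence $a_0,a_1,\dots,a_n$ with $a_j$ a vertex for $j$ even and an edge for $j$ odd (all distinct), and incidences $i_1,\dots,i_n$, where $i_j$ joins $a_{j-1}$ and $a_j$ (so $\varsigma(i_j)$ is whichever of $a_{j-1},a_j$ is a vertex and $\omega(i_j)$ the one that is an edge). $P_n$ is the path multigraph with $n+1$ vertices and $n$ edges. Set-system hypergraphs: $(V,E,\epsilon:E\to\mathcal PV)$; homomorphisms $(V\phi,E\phi)$ with $\epsilon_H(E\phi(e))=V\phi[\epsilon_G(e)]$; category $\mathfrak H$. Multigraphs: those with $1\le|\epsilon(e)|\le2$. Set-system box exponential $[G,H]_\beta$: vertices $\mathfrak H(G,H)$; edges $\{(A,g):A\subseteq\mathfrak H(G,H),\ g:V(G)\to E(H),\ \epsilon_H(g(v))=\{V(\phi)(v):\phi\in A\}\ \forall v\}$; $\epsilon(A,g)=A$. $\mathrm{Del}$ deletes edges $e$ with $|\epsilon(e)|\notin\{1,2\}$. Incidence hypergraphs: $(\check V,\check E,I,\varsigma:I\to\check V,\omega:I\to\check E)$, homomorphisms commute with $\varsigma,\omega$; category $\mathfrak R$. Incidence dual $K^\#$ swaps vertices/edges and $\varsigma/\omega$. Laplacian product $K\blacksquare M$: vertices $(\{1\}\times\check V(K)\times\check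 V(M))\cup(\{4\}\times\check E(K)\times\check E(M))$, edges $(\{2\}\times\check E(K)\times\check V(M))\cup(\{3\}\times\check V(K)\times\check E(M))$, incidences $(\{1\}\times I(K)\times\check V(M))\cup(\{2\}\times I(K)\times\check E(M))\cup(\{3\}\times\check E(K)\times I(M))\cup(\{4\}\times\check V(K)\times I(M))$, $\varsigma(1,x,y)=(1,\varsigma_Kx,y)$, $\varsigma(2,x,y)=(4,\omega_Kx,y)$, $\varsigma(3,x,y)=(4,x,\omega_My)$, $\varsigma(4,x,y)=(1,x,\varsigma_My)$, $\omega(1,x,y)=(2,\omega_Kx,y)$, $\omega(2,x,y)=(3,\varsigma_Kx,y)$, $\omega(3,x,y)=(2,x,\varsigma_My)$, $\omega(4,x,y)=(3,x,\omega_My)$. $[K,M]_L$ is the Laplacian exponential, the right adjoint of $K\blacksquare(-)$: vertices $\mathfrak R(K,M)$, edges $\mathfrak R(K^\#,M)$, incidences $\mathfrak R(K\blacksquare I^\diamond(\{1\}),M)$ ($I^\diamond(\{1\})$: one vertex, one edge, one incidence), with $\varsigma,\omega$ given by restriction along the copies of $K$ and $K^\#$ in $K\blacksquare I^\diamond(\{1\})$ corresponding to the vertex and the edge of $I^\diamond(\{1\})$. $\vec D$: multigraph $G\mapsto$ quiver with vertices $V(G)$, edges $\{(e,x,y):\epsilon_G(e)=\{x,y\}\}$, source $x$, target $y$. $\Upsilon$: quiver $Q\mapsto(\vec V(Q),\vec V(Q),\vec E(Q),\sigma_Q,\tau_Q)\in\mathfrak R$. -}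

module Defs where

-- Every "set" of the paper is a
-- Setoid, every "function" is a congruence (Func), subsets of a set are
-- predicates respecting the equality, and isomorphisms are Inverses.

open import Level using (Level; _⊔_; 0ℓ) renaming (suc to lsuc)
open import Data.Nat.Base using (ℕ; zero; suc; s≤s; ⌊_/2⌋; ⌈_/2⌉)
open import Data.Nat.Properties using (⌊n/2⌋-mono)
open import Data.Fin.Base as F using (Fin; toℕ; fromℕ<; inject₁)
open import Data.Fin.Properties using (toℕ<n)
open import Data.Unit.Base using (⊤; tt)
open import Data.Product.Base using (Σ; ∃; ∃₂; _×_; _,_; proj₁; proj₂)
open import Data.Sum.Base using (_⊎_; inj₁; inj₂)
open import Relation.Binary.Bundles using (Setoid)
open import Relation.Binary.PropositionalEquality as ≡ using (_≡_)
open import Function.Bundles using (Func; Inverse; _⇔_; mk⇔; Equivalence)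
open import Data.Product.Relation.Binary.Pointwise.NonDependent using (×-setoid)
import Data.Sum.Relation.Binary.Pointwise as PW

module _ {a ℓ b ℓ' : Level} {S : Setoid a ℓ} {T : Setoid b ℓ'} where
  app : Func S T → Setoid.Carrier S → Setoid.Carrier T
  app = Func.to

≡-func : ∀ {a b} {A : Set a} {B : Set b} → (A → B) → Func (≡.setoid A) (≡.setoid B)
≡-func f = record { to = f ; cong = ≡.cong f }

record Subset {a ℓ : Level} (S : Setoid a ℓ) (p : Level) : Set (a ⊔ ℓ ⊔ lsuc p) where
  open Setoid S
  field
    mem      : Carrier → Set p
    mem-resp : ∀ {x y} → x ≈ y → mem x → mem y
open Subset public

_≐_ : ∀ {a ℓ p q} {S : Setoid a ℓ} → Subset S p → Subset S q → Set (a ⊔ p ⊔ q)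
_≐_ {S = S} A B = ∀ x → (mem A x ⇔ mem B x)

≐-refl : ∀ {a ℓ p} {S : Setoid a ℓ} {A : Subset S p} → A ≐ A
≐-refl x = mk⇔ (λ z → z) (λ z → z)

≐-sym : ∀ {a ℓ p q} {S : Setoid a ℓ} {A : Subset S p} {B : Subset S q} → A ≐ B → B ≐ A
≐-sym e x = mk⇔ (Equivalence.from (e x)) (Equivalence.to (e x))

≐-trans : ∀ {a ℓ p q r} {S : Setoid a ℓ} {A : Subset S p} {B : Subset S q} {C : Subset S r}
        → A ≐ B → B ≐ C → A ≐ C
≐-trans e f x = mk⇔ (λ z → Equivalence.to (f x) (Equivalence.to (e x) z))
                    (λ z → Equivalence.from (e x) (Equivalence.from (f x) z))

pair : ∀ {a ℓ} (S : Setoid a ℓ) → Setoid.Carrier S → Setoid.Carrier S → Subset S ℓ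
pair S x y = record
  { mem      = λ z → z ≈ x ⊎ z ≈ y
  ; mem-resp = λ { z≈w (inj₁ p) → inj₁ (trans (sym z≈w) p)
                 ; z≈w (inj₂ p) → inj₂ (trans (sym z≈w) p) } }
  where open Setoid S

-- "A has one or two elements", i.e. 1 ≤ |A| ≤ 2  (A = {x , y} for some x, y)
OneOrTwo : ∀ {a ℓ p} {S : Setoid a ℓ} → Subset S p → Set (a ⊔ ℓ ⊔ p)
OneOrTwo {S = S} A = ∃₂ λ x y → A ≐ pair S x y

image : ∀ {a ℓ b ℓ' p} {S : Setoid a ℓ} {T : Setoid b ℓ'}
      → Func S T → Subset S p → Subset T (a ⊔ p ⊔ ℓ')
image {T = T} f A = record
  { mem      = λ w → ∃ λ v → mem A v × Setoid._≈_ T (Func.to f v) w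
  ; mem-resp = λ { w≈w' (v , m , e) → v , m , Setoid.trans T e w≈w' } }

Restrict : ∀ {a ℓ p} (S : Setoid a ℓ) → (Setoid.Carrier S → Set p) → Setoid (a ⊔ p) ℓ
Restrict S P = record
  { Carrier       = Σ (Setoid.Carrier S) P
  ; _≈_           = λ x y → Setoid._≈_ S (proj₁ x) (proj₁ y)
  ; isEquivalence = record { refl = Setoid.refl S ; sym = Setoid.sym S ; trans = Setoid.trans S } }

record SetSys (a ℓa b ℓb p : Level) : Set (lsuc (a ⊔ ℓa ⊔ b ⊔ ℓb ⊔ p)) where
  field
    V      : Setoid a ℓa
    E      : Setoid b ℓb
    ε      : Setoid.Carrier E → Subset V p
    ε-cong : ∀ {e e'} → Setoid._≈_ E e e' → ε e ≐ ε e'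
open SetSys public

IsMultigraph : ∀ {a ℓa b ℓb p} → SetSys a ℓa b ℓb p → Set (a ⊔ ℓa ⊔ b ⊔ p)
IsMultigraph G = ∀ e → OneOrTwo (ε G e)

module _ {a ℓa b ℓb p a' ℓa' b' ℓb' p' : Level}
         (G : SetSys a ℓa b ℓb p) (H : SetSys a' ℓa' b' ℓb' p') where

  record SHom : Set (a ⊔ ℓa ⊔ b ⊔ ℓb ⊔ p ⊔ a' ⊔ ℓa' ⊔ b' ⊔ ℓb' ⊔ p') where
    field
      hV  : Func (V G) (V H)
      hE  : Func (E G) (E H)
      hom : ∀ e → ε H (Func.to hE e) ≐ image hV (ε G e)
  open SHom public

  SHomSetoid : Setoid (a ⊔ ℓa ⊔ b ⊔ ℓb ⊔ p ⊔ a' ⊔ ℓa' ⊔ b' ⊔ ℓb' ⊔ p') (a ⊔ ℓa' ⊔ b ⊔ ℓb')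
  SHomSetoid = record
    { Carrier       = SHom
    ; _≈_           = λ f g → (∀ v → Setoid._≈_ (V H) (Func.to (hV f) v) (Func.to (hV g) v))
                            × (∀ e → Setoid._≈_ (E H) (Func.to (hE f) e) (Func.to (hE g) e))
    ; isEquivalence = record
      { refl  = (λ v → Setoid.refl (V H)) , (λ e → Setoid.refl (E H))
      ; sym   = λ { (p , q) → (λ v → Setoid.sym (V H) (p v)) , (λ e → Setoid.sym (E H) (q e)) }
      ; trans = λ { (p , q) (p' , q') → (λ v → Setoid.trans (V H) (p v) (p' v))
                                      , (λ e → Setoid.trans (E H) (q e) (q' e)) } } }

  evalAt : Setoid.Carrier (V G) → Func SHomSetoid (V H)
  evalAt v = record { to = λ φ → Func.to (hV φ) v ; cong = λ e → proj₁ e v }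

  homL : Level
  homL = a ⊔ ℓa ⊔ b ⊔ ℓb ⊔ p ⊔ a' ⊔ ℓa' ⊔ b' ⊔ ℓb' ⊔ p'

  record BoxEdge : Set (lsuc homL) where
    field
      A    : Subset SHomSetoid homL
      g    : Func (V G) (E H)
      g-ok : ∀ v → ε H (Func.to g v) ≐ image (evalAt v) A
  open BoxEdge public

  BoxEdgeSetoid : Setoid (lsuc homL) (a ⊔ ℓb' ⊔ homL)
  BoxEdgeSetoid = record
    { Carrier       = BoxEdge
    ; _≈_           = λ x y → (A x ≐ A y) × (∀ v → Setoid._≈_ (E H) (Func.to (g x) v) (Func.to (g y) v))
    ; isEquivalence = record
      { refl  = λ {x} → ≐-refl {A = A x} , (λ v → Setoid.refl (E H))
      ; sym   = λ {x} {y} → λ { (p , q) → ≐-sym {A = A x} {B = A y} p , (λ v → Setoid.sym (E H) (q v)) }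
      ; trans = λ {x} {y} {z} → λ { (p , q) (p' , q') →
                  ≐-trans {A = A x} {B = A y} {C = A z} p p' , (λ v → Setoid.trans (E H) (q v) (q' v)) } } }

  boxExp : SetSys _ _ _ _ _
  boxExp = record
    { V      = SHomSetoid
    ; E      = BoxEdgeSetoid
    ; ε      = A
    ; ε-cong = proj₁ }

Del : ∀ {a ℓa b ℓb p} → SetSys a ℓa b ℓb p → SetSys a ℓa (a ⊔ ℓa ⊔ b ⊔ p) ℓb p
Del G = record
  { V      = V G
  ; E      = Restrict (E G) (λ e → OneOrTwo (ε G e))
  ; ε      = λ e → ε G (proj₁ e)
  ; ε-cong = ε-cong G }

record Quiver (a ℓa b ℓb : Level) : Set (lsuc (a ⊔ ℓa ⊔ b ⊔ ℓb)) where
  field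
    QV : Setoid a ℓa
    QE : Setoid b ℓb
    σ  : Func QE QV
    τ  : Func QE QV
open Quiver public

D⃗ : ∀ {a ℓa b ℓb p} → SetSys a ℓa b ℓb p → Quiver a ℓa (a ⊔ ℓa ⊔ b ⊔ p) (ℓa ⊔ ℓb)
D⃗ G = record
  { QV = V G
  ; QE = record
    { Carrier       = Σ (Setoid.Carrier (E G)) λ e → ∃₂ λ x y → ε G e ≐ pair (V G) x y
    ; _≈_           = λ { (e , x , y , _) (e' , x' , y' , _) →
                          Setoid._≈_ (E G) e e' × Setoid._≈_ (V G) x x' × Setoid._≈_ (V G) y y' }
    ; isEquivalence = record
      { refl  = Setoid.refl (E G) , Setoid.refl (V G) , Setoid.refl (V G)
      ; sym   = λ { (p , q , r) → Setoid.sym (E G) p , Setoid.sym (V G) q , Setoid.sym (V G) r }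
      ; trans = λ { (p , q , r) (p' , q' , r') →
                    Setoid.trans (E G) p p' , Setoid.trans (V G) q q' , Setoid.trans (V G) r r' } } }
  ; σ  = record { to = λ { (e , x , y , _) → x } ; cong = λ { (p , q , r) → q } }
  ; τ  = record { to = λ { (e , x , y , _) → y } ; cong = λ { (p , q , r) → r } } }

record IncHyp (v ℓv e ℓe i ℓi : Level) : Set (lsuc (v ⊔ ℓv ⊔ e ⊔ ℓe ⊔ i ⊔ ℓi)) where
  field
    IV : Setoid v ℓv
    IE : Setoid e ℓe
    II : Setoid i ℓi
    ς  : Func II IV
    ω  : Func II IE
open IncHyp public

Υ : ∀ {a ℓa b ℓb} → Quiver a ℓa b ℓb → IncHyp a ℓa a ℓa b ℓb
Υ Q = record { IV = QV Q ; IE = QV Q ; II = QE Q ; ς = σ Q ; ω = τ Q }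

_# : ∀ {v ℓv e ℓe i ℓi} → IncHyp v ℓv e ℓe i ℓi → IncHyp e ℓe v ℓv i ℓi
K # = record { IV = IE K ; IE = IV K ; II = II K ; ς = ω K ; ω = ς K }

module _ {v ℓv e ℓe i ℓi v' ℓv' e' ℓe' i' ℓi' : Level}
         (K : IncHyp v ℓv e ℓe i ℓi) (M : IncHyp v' ℓv' e' ℓe' i' ℓi') where

  record IHom : Set (v ⊔ ℓv ⊔ e ⊔ ℓe ⊔ i ⊔ ℓi ⊔ v' ⊔ ℓv' ⊔ e' ⊔ ℓe' ⊔ i' ⊔ ℓi') where
    field
      fV : Func (IV K) (IV M)
      fE : Func (IE K) (IE M)
      fI : Func (II K) (II M)
      ς-comm : ∀ x → Setoid._≈_ (IV M) (Func.to fV (Func.to (ς K) x)) (Func.to (ς M) (Func.to fI x))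
      ω-comm : ∀ x → Setoid._≈_ (IE M) (Func.to fE (Func.to (ω K) x)) (Func.to (ω M) (Func.to fI x))
  open IHom public

  IHomSetoid : Setoid _ (v ⊔ ℓv' ⊔ e ⊔ ℓe' ⊔ i ⊔ ℓi')
  IHomSetoid = record
    { Carrier       = IHom
    ; _≈_           = λ f g → (∀ x → Setoid._≈_ (IV M) (Func.to (fV f) x) (Func.to (fV g) x))
                            × (∀ x → Setoid._≈_ (IE M) (Func.to (fE f) x) (Func.to (fE g) x))
                            × (∀ x → Setoid._≈_ (II M) (Func.to (fI f) x) (Func.to (fI g) x))
    ; isEquivalence = record
      { refl  = (λ x → Setoid.refl (IV M)) , (λ x → Setoid.refl (IE M)) , (λ x → Setoid.refl (II M))
      ; sym   = λ { (p , q , r) → (λ x → Setoid.sym (IV M) (p x)) , (λ x → Setoid.sym (IE M) (q x))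
                                , (λ x → Setoid.sym (II M) (r x)) }
      ; trans = λ { (p , q , r) (p' , q' , r') →
                    (λ x → Setoid.trans (IV M) (p x) (p' x)) , (λ x → Setoid.trans (IE M) (q x) (q' x))
                  , (λ x → Setoid.trans (II M) (r x) (r' x)) } } }

  record IIso : Set (v ⊔ ℓv ⊔ e ⊔ ℓe ⊔ i ⊔ ℓi ⊔ v' ⊔ ℓv' ⊔ e' ⊔ ℓe' ⊔ i' ⊔ ℓi') where
    field
      isoV : Inverse (IV K) (IV M)
      isoE : Inverse (IE K) (IE M)
      isoI : Inverse (II K) (II M)
      ς-comm : ∀ x → Setoid._≈_ (IV M) (Inverse.to isoV (Func.to (ς K) x))
                                        (Func.to (ς M) (Inverse.to isoI x))
      ω-comm : ∀ x → Setoid._≈_ (IE M) (Inverse.to isoE (Func.to (ω K) x))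
                                        (Func.to (ω M) (Inverse.to isoI x))

precomp : ∀ {v ℓv e ℓe i ℓi v' ℓv' e' ℓe' i' ℓi' v'' ℓv'' e'' ℓe'' i'' ℓi''}
            {K : IncHyp v ℓv e ℓe i ℓi} {L : IncHyp v' ℓv' e' ℓe' i' ℓi'}
            {M : IncHyp v'' ℓv'' e'' ℓe'' i'' ℓi''}
        → IHom K L → Func (IHomSetoid L M) (IHomSetoid K M)
precomp {K = K} {L} {M} ι = record
  { to   = λ φ → record
    { fV = comp (fV φ) (fV ι) ; fE = comp (fE φ) (fE ι) ; fI = comp (fI φ) (fI ι)
    ; ς-comm = λ x → Setoid.trans (IV M) (Func.cong (fV φ) (ς-comm ι x)) (ς-comm φ (Func.to (fI ι) x))
    ; ω-comm = λ x → Setoid.trans (IE M) (Func.cong (fE φ) (ω-comm ι x)) (ω-comm φ (Func.to (fI ι) x)) }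
  ; cong = λ { (p , q , r) → (λ x → p (Func.to (fV ι) x)) , (λ x → q (Func.to (fE ι) x))
                           , (λ x → r (Func.to (fI ι) x)) } }
  where
  comp : ∀ {a b c α β γ} {A : Setoid a α} {B : Setoid b β} {C : Setoid c γ}
       → Func B C → Func A B → Func A C
  comp f g = record { to = λ x → Func.to f (Func.to g x) ; cong = λ p → Func.cong f (Func.cong g p) }

-- Laplacian product K ■ M
-- tags: vertices 1 = inj₁ (V̌K × V̌M), 4 = inj₂ (ĚK × ĚM);
--       edges    2 = inj₁ (ĚK × V̌M), 3 = inj₂ (V̌K × ĚM);
--       incidences 1 = inj₁ (inj₁ (I K × V̌M)), 2 = inj₁ (inj₂ (I K × ĚM)),
--                  3 = inj₂ (inj₁ (ĚK × I M)), 4 = inj₂ (inj₂ (V̌K × I M)).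

_■_ : ∀ {v ℓv e ℓe i ℓi v' ℓv' e' ℓe' i' ℓi'}
    → IncHyp v ℓv e ℓe i ℓi → IncHyp v' ℓv' e' ℓe' i' ℓi' → IncHyp _ _ _ _ _ _
K ■ M = record
  { IV = PW.⊎-setoid (×-setoid (IV K) (IV M)) (×-setoid (IE K) (IE M))
  ; IE = PW.⊎-setoid (×-setoid (IE K) (IV M)) (×-setoid (IV K) (IE M))
  ; II = PW.⊎-setoid (PW.⊎-setoid (×-setoid (II K) (IV M)) (×-setoid (II K) (IE M)))
                     (PW.⊎-setoid (×-setoid (IE K) (II M)) (×-setoid (IV K) (II M)))
  ; ς  = record
    { to   = λ { (inj₁ (inj₁ (x , y))) → inj₁ (ςK x , y)
               ; (inj₁ (inj₂ (x , y))) → inj₂ (ωK x , y)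
               ; (inj₂ (inj₁ (x , y))) → inj₂ (x , ωM y)
               ; (inj₂ (inj₂ (x , y))) → inj₁ (x , ςM y) }
    ; cong = λ { (PW.inj₁ (PW.inj₁ (p , q))) → PW.inj₁ (Func.cong (ς K) p , q)
               ; (PW.inj₁ (PW.inj₂ (p , q))) → PW.inj₂ (Func.cong (ω K) p , q)
               ; (PW.inj₂ (PW.inj₁ (p , q))) → PW.inj₂ (p , Func.cong (ω M) q)
               ; (PW.inj₂ (PW.inj₂ (p , q))) → PW.inj₁ (p , Func.cong (ς M) q) } }
  ; ω  = record
    { to   = λ { (inj₁ (inj₁ (x , y))) → inj₁ (ωK x , y)
               ; (inj₁ (inj₂ (x , y))) → inj₂ (ςK x , y)
               ; (inj₂ (inj₁ (x , y))) → inj₁ (x , ςM y)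
               ; (inj₂ (inj₂ (x , y))) → inj₂ (x , ωM y) }
    ; cong = λ { (PW.inj₁ (PW.inj₁ (p , q))) → PW.inj₁ (Func.cong (ω K) p , q)
               ; (PW.inj₁ (PW.inj₂ (p , q))) → PW.inj₂ (Func.cong (ς K) p , q)
               ; (PW.inj₂ (PW.inj₁ (p , q))) → PW.inj₁ (p , Func.cong (ς M) q)
               ; (PW.inj₂ (PW.inj₂ (p , q))) → PW.inj₂ (p , Func.cong (ω M) q) } } }
  where
  ςK = Func.to (ς K)
  ωK = Func.to (ω K)
  ςM = Func.to (ς M)
  ωM = Func.to (ω M)

I◇1 : IncHyp 0ℓ 0ℓ 0ℓ 0ℓ 0ℓ 0ℓ
I◇1 = record
  { IV = ≡.setoid ⊤ ; IE = ≡.setoid ⊤ ; II = ≡.setoid ⊤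
  ; ς = ≡-func (λ _ → tt) ; ω = ≡-func (λ _ → tt) }

module _ {v ℓv e ℓe i ℓi : Level} (K : IncHyp v ℓv e ℓe i ℓi) where

  ιV : IHom K (K ■ I◇1)
  ιV = record
    { fV = record { to = λ x → inj₁ (x , tt) ; cong = λ p → PW.inj₁ (p , ≡.refl) }
    ; fE = record { to = λ x → inj₁ (x , tt) ; cong = λ p → PW.inj₁ (p , ≡.refl) }
    ; fI = record { to = λ x → inj₁ (inj₁ (x , tt)) ; cong = λ p → PW.inj₁ (PW.inj₁ (p , ≡.refl)) }
    ; ς-comm = λ x → PW.inj₁ (Setoid.refl (IV K) , ≡.refl)
    ; ω-comm = λ x → PW.inj₁ (Setoid.refl (IE K) , ≡.refl) }

  ιE : IHom (K #) (K ■ I◇1)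
  ιE = record
    { fV = record { to = λ x → inj₂ (x , tt) ; cong = λ p → PW.inj₂ (p , ≡.refl) }
    ; fE = record { to = λ x → inj₂ (x , tt) ; cong = λ p → PW.inj₂ (p , ≡.refl) }
    ; fI = record { to = λ x → inj₁ (inj₂ (x , tt)) ; cong = λ p → PW.inj₁ (PW.inj₂ (p , ≡.refl)) }
    ; ς-comm = λ x → PW.inj₂ (Setoid.refl (IE K) , ≡.refl)
    ; ω-comm = λ x → PW.inj₂ (Setoid.refl (IV K) , ≡.refl) }

lapExp : ∀ {v ℓv e ℓe i ℓi v' ℓv' e' ℓe' i' ℓi'}
       → IncHyp v ℓv e ℓe i ℓi → IncHyp v' ℓv' e' ℓe' i' ℓi' → IncHyp _ _ _ _ _ _
lapExp K M = record
  { IV = IHomSetoid K M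
  ; IE = IHomSetoid (K #) M
  ; II = IHomSetoid (K ■ I◇1) M
  ; ς  = precomp (ιV K)
  ; ω  = precomp (ιE K) }

-- P̌_{n/2}: a₀,a₁,…,aₙ with vertices a_{2k} (k ≤ ⌊n/2⌋), edges a_{2k+1}
-- (k < ⌈n/2⌉) and incidences i₁,…,iₙ (i_{j+1} encoded as j : Fin n) joining
-- a_j and a_{j+1}: its vertex end is a_{2⌈j/2⌉}, its edge end a_{2⌊j/2⌋+1}.
P̌ : ℕ → IncHyp 0ℓ 0ℓ 0ℓ 0ℓ 0ℓ 0ℓ
P̌ n = record
  { IV = ≡.setoid (Fin (suc ⌊ n /2⌋))
  ; IE = ≡.setoid (Fin ⌈ n /2⌉)
  ; II = ≡.setoid (Fin n)
  ; ς  = ≡-func (λ j → fromℕ< {⌈ toℕ j /2⌉} (s≤s (⌊n/2⌋-mono (toℕ<n j))))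
  ; ω  = ≡-func (λ j → fromℕ< {⌊ toℕ j /2⌋} (⌊n/2⌋-mono (s≤s (toℕ<n j)))) }

P : ℕ → SetSys 0ℓ 0ℓ 0ℓ 0ℓ 0ℓ
P n = record
  { V      = ≡.setoid (Fin (suc n))
  ; E      = ≡.setoid (Fin n)
  ; ε      = λ j → pair (≡.setoid (Fin (suc n))) (inject₁ j) (F.suc j)
  ; ε-cong = λ { {j} ≡.refl → ≐-refl {A = pair (≡.setoid (Fin (suc n))) (inject₁ j) (F.suc j)} } }

module Submission where

-- A homomorphism from P̌_{n/2}, or from its dual, into Υ D⃗ G sends the n + 1
-- points a₀, …, aₙ of the path to vertices of G and the incidence i_{j+1} to an
-- edge of G joining the images of a_j and a_{j+1}: it is a walk P_n → G.  A
-- homomorphism from P̌_{n/2} ■ I◇({1}) consists of two such walks x and y (the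
-- copies of P̌ and of P̌^# over the vertex and the edge of I◇({1})) together with,
-- for each point i, an edge of G with ends x(i) and y(i): a "ladder".  An arc of
-- Υ D⃗ Del [P_n, G]_β is the same data, since an edge (A, g) of the box exponential
-- with A = {x, y} assigns to each point i an edge g(i) with ends {x(i), y(i)}.
-- Nothing about P̌_{n/2} is used beyond the arrangement of its vertices and
-- edges along the path, and P̌^# is arranged along the same path with the roles
-- of vertices and edges exchanged.

open import Defs
open import Level using (0ℓ; Lift; lift; lower; _⊔_)
open import Data.Nat.Base using (ℕ; zero; suc; ⌊_/2⌋; ⌈_/2⌉)
open import Data.Fin.Base using (Fin; zero; suc; inject₁)
open import Data.Product.Base using (_×_; _,_; proj₁; proj₂)
open import Data.Sum.Base as Sum using (_⊎_; inj₁; inj₂; [_,_]′; swap)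
open import Data.Sum.Algebra using (⊎-comm)
open import Data.Unit.Base using (tt)
import Data.Sum.Relation.Binary.Pointwise as PW
open import Function.Base using (_∘_)
open import Function.Bundles using (Func; Inverse; Equivalence; _↔_; mk⇔; mk↔ₛ′)
open import Function.Construct.Composition using (inverse) renaming (equivalence to ⇔-trans)
open import Function.Construct.Symmetry using (⇔-sym)
open import Function.Consequences.Setoid using (strictlyInverseˡ⇒inverseˡ; strictlyInverseʳ⇒inverseʳ)
open import Relation.Binary.Bundles using (Setoid)
open import Relation.Binary.PropositionalEquality as ≡ using (_≡_; refl)

discreteFunc : ∀ {b ℓ c} {T : Setoid b ℓ} {A : Set c} → (A → Setoid.Carrier T) → Func (≡.setoid A) T
discreteFunc {T = T} f = record { to = f ; cong = λ { refl → Setoid.refl T } }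

module _ {a ℓ b ℓ′} {S : Setoid a ℓ} {T : Setoid b ℓ′} where
  private
    module S = Setoid S
    module T = Setoid T

  mkInverse : (to : Func S T) (from : Func T S)
            → (∀ y → Func.to to (Func.to from y) T.≈ y)
            → (∀ x → Func.to from (Func.to to x) S.≈ x)
            → Inverse S T
  mkInverse to from invˡ invʳ = record
    { to        = Func.to to
    ; from      = Func.to from
    ; to-cong   = Func.cong to
    ; from-cong = Func.cong from
    ; inverse   = strictlyInverseˡ⇒inverseˡ S T (Func.cong to) invˡ
                , strictlyInverseʳ⇒inverseʳ S T (Func.cong from) invʳ }

  image-cong : ∀ (f : Func S T) {p q} {A : Subset S p} {B : Subset S q} → A ≐ B → image f A ≐ image f B
  image-cong f A≐B w = mk⇔ (λ { (v , v∈A , fv≈w) → v , Equivalence.to (A≐B v) v∈A , fv≈w })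
                           (λ { (v , v∈B , fv≈w) → v , Equivalence.from (A≐B v) v∈B , fv≈w })

  image-pair : ∀ (f : Func S T) x y → image f (pair S x y) ≐ pair T (Func.to f x) (Func.to f y)
  image-pair f x y w = mk⇔
    (λ { (v , inj₁ v≈x , fv≈w) → inj₁ (T.trans (T.sym fv≈w) (Func.cong f v≈x))
       ; (v , inj₂ v≈y , fv≈w) → inj₂ (T.trans (T.sym fv≈w) (Func.cong f v≈y)) })
    (λ { (inj₁ w≈fx) → x , inj₁ S.refl , T.sym w≈fx
       ; (inj₂ w≈fy) → y , inj₂ S.refl , T.sym w≈fy })

module _ {a ℓ} (S : Setoid a ℓ) where
  open Setoid S

  pair-comm : ∀ x y → pair S x y ≐ pair S y x
  pair-comm x y z = mk⇔ swap swap

  pair-cong : ∀ {x x′ y y′} → x ≈ x′ → y ≈ y′ → pair S x y ≐ pair S x′ y′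
  pair-cong x≈x′ y≈y′ z = mk⇔ (Sum.map (λ q → trans q x≈x′) (λ q → trans q y≈y′))
                              (Sum.map (λ q → trans q (sym x≈x′)) (λ q → trans q (sym y≈y′)))

  liftSubset : ∀ {p} q → Subset S p → Subset S (p ⊔ q)
  liftSubset q A = record { mem = λ x → Lift q (mem A x) ; mem-resp = λ x≈y m → lift (mem-resp A x≈y (lower m)) }

  liftSubset≐ : ∀ {p} q (A : Subset S p) → liftSubset q A ≐ A
  liftSubset≐ q A x = mk⇔ lower lift

module _ {a ℓa b ℓb p a′ ℓa′ b′ ℓb′ p′}
         (F : SetSys a ℓa b ℓb p) (G : SetSys a′ ℓa′ b′ ℓb′ p′) where
  private
    module EG = Setoid (E G)
    module Hom = Setoid (SHomSetoid F G)

  record Ladder : Set (homL F G) where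
    field
      rail₁ rail₂ : SHom F G
      rung        : Func (V F) (E G)
      rung-joins  : ∀ v → ε G (app rung v) ≐ pair (V G) (app (hV rail₁) v) (app (hV rail₂) v)
  open Ladder

  LadderSetoid : Setoid (homL F G) (a ⊔ ℓa′ ⊔ b ⊔ ℓb′)
  LadderSetoid = record
    { Carrier       = Ladder
    ; _≈_           = λ l l′ → rail₁ l Hom.≈ rail₁ l′ × rail₂ l Hom.≈ rail₂ l′
                             × (∀ v → app (rung l) v EG.≈ app (rung l′) v)
    ; isEquivalence = record
      { refl  = λ {l} → Hom.refl {rail₁ l} , Hom.refl {rail₂ l} , λ v → EG.refl
      ; sym   = λ {l} {l′} → λ { (p₁ , p₂ , r) →
                  Hom.sym {rail₁ l} {rail₁ l′} p₁ , Hom.sym {rail₂ l} {rail₂ l′} p₂ , EG.sym ∘ r }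
      ; trans = λ {l} {l′} {l″} → λ { (p₁ , p₂ , r) (q₁ , q₂ , s) →
                  Hom.trans {rail₁ l} {rail₁ l′} {rail₁ l″} p₁ q₁
                , Hom.trans {rail₂ l} {rail₂ l′} {rail₂ l″} p₂ q₂ , λ v → EG.trans (r v) (s v) } } }

  private
    Arcs = QE (D⃗ (Del (boxExp F G)))
    Arc  = Setoid.Carrier Arcs

    pairHom : SHom F G → SHom F G → Subset (SHomSetoid F G) (homL F G)
    pairHom x y = liftSubset (SHomSetoid F G) (homL F G) (pair (SHomSetoid F G) x y)

    evaluate-pair : ∀ {q} (A : Subset (SHomSetoid F G) q) x y → A ≐ pair (SHomSetoid F G) x y
                  → ∀ v → image (evalAt F G v) A ≐ pair (V G) (app (hV x) v) (app (hV y) v)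
    evaluate-pair A x y A≐xy v w =
      ⇔-trans (image-cong (evalAt F G v) {A = A} {B = pair (SHomSetoid F G) x y} A≐xy w)
              (image-pair (evalAt F G v) x y w)

    pairHom-cong : ∀ {x x′ y y′} → x Hom.≈ x′ → y Hom.≈ y′ → pairHom x y ≐ pairHom x′ y′
    pairHom-cong {x} {x′} {y} {y′} x≈x′ y≈y′ z = mk⇔
      (λ { (lift m) → lift (Equivalence.to (pair-cong (SHomSetoid F G) {x} {x′} {y} {y′} x≈x′ y≈y′ z) m) })
      (λ { (lift m) → lift (Equivalence.from (pair-cong (SHomSetoid F G) {x} {x′} {y} {y′} x≈x′ y≈y′ z) m) })

    arc⇒ladder : Arc → Ladder
    arc⇒ladder ((e , _) , x , y , A≐xy) = record
      { rail₁ = x ; rail₂ = y ; rung = g e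
      ; rung-joins = λ v w → ⇔-trans (g-ok e v w) (evaluate-pair (A e) x y A≐xy v w) }

    ladder⇒arc : Ladder → Arc
    ladder⇒arc l = (edge , x , y , A≐xy) , x , y , A≐xy
      where
      x = rail₁ l
      y = rail₂ l
      A≐xy = liftSubset≐ (SHomSetoid F G) (homL F G) (pair (SHomSetoid F G) x y)
      edge : BoxEdge F G
      edge = record
        { A = pairHom x y ; g = rung l
        ; g-ok = λ v w → ⇔-trans (rung-joins l v w) (⇔-sym (evaluate-pair (pairHom x y) x y A≐xy v w)) }

  ladder↔arc : Inverse LadderSetoid Arcs
  ladder↔arc = mkInverse
    (record { to = ladder⇒arc
            ; cong = λ {l} {l′} → λ { (x≈ , y≈ , g≈) →
                (pairHom-cong {rail₁ l} {rail₁ l′} {rail₂ l} {rail₂ l′} x≈ y≈ , g≈) , x≈ , y≈ } })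
    (record { to = arc⇒ladder ; cong = λ ((_ , g≈) , x≈ , y≈) → x≈ , y≈ , g≈ })
    (λ { (_ , x , y , A≐xy) →
          ((λ z → ⇔-trans (liftSubset≐ (SHomSetoid F G) (homL F G) (pair (SHomSetoid F G) x y) z)
                          (⇔-sym (A≐xy z)))
          , λ v → EG.refl) , Hom.refl {x} , Hom.refl {y} })
    (λ l → Hom.refl {rail₁ l} , Hom.refl {rail₂ l} , λ v → EG.refl)

Joins : ∀ {n} → Fin n → Fin (suc n) → Fin (suc n) → Set
Joins j c d = (c ≡ inject₁ j × d ≡ suc j) ⊎ (c ≡ suc j × d ≡ inject₁ j)

Joins-comm : ∀ {n} {j : Fin n} {c d} → Joins j c d → Joins j d c
Joins-comm (inj₁ (c≡ , d≡)) = inj₂ (d≡ , c≡)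
Joins-comm (inj₂ (c≡ , d≡)) = inj₁ (d≡ , c≡)

Joins-suc-suc : ∀ {n} {j : Fin n} {c d} → Joins j c d → Joins (suc (suc j)) (suc (suc c)) (suc (suc d))
Joins-suc-suc (inj₁ (refl , refl)) = inj₁ (refl , refl)
Joins-suc-suc (inj₂ (refl , refl)) = inj₂ (refl , refl)

Joins⇒pair≐image : ∀ {s ℓ n} {S : Setoid s ℓ} (f : Func (V (P n)) S) {j c d} → Joins j c d
                 → pair S (Func.to f c) (Func.to f d) ≐ image f (ε (P n) j)
Joins⇒pair≐image f (inj₁ (refl , refl)) w = ⇔-sym (image-pair f _ _ w)
Joins⇒pair≐image {S = S} f (inj₂ (refl , refl)) w = ⇔-trans (pair-comm S _ _ w) (⇔-sym (image-pair f _ _ w))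

record PathLayout (n : ℕ) : Set₁ where
  field
    Vertex Edge : Set
    vertexOf    : Fin n → Vertex
    edgeOf      : Fin n → Edge
    position    : (Vertex ⊎ Edge) ↔ Fin (suc n)
    ends        : ∀ j → Joins j (Inverse.to position (inj₁ (vertexOf j)))
                                (Inverse.to position (inj₂ (edgeOf j)))

  incHyp : IncHyp 0ℓ 0ℓ 0ℓ 0ℓ 0ℓ 0ℓ
  incHyp = record { IV = ≡.setoid Vertex ; IE = ≡.setoid Edge ; II = ≡.setoid (Fin n)
                  ; ς = ≡-func vertexOf ; ω = ≡-func edgeOf }

  pos : Vertex ⊎ Edge → Fin (suc n)
  pos = Inverse.to position

  pointAt : Fin (suc n) → Vertex ⊎ Edge
  pointAt = Inverse.from position

  pointAt-pos : ∀ s → pointAt (pos s) ≡ s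
  pointAt-pos = Inverse.strictlyInverseʳ position

  pos-pointAt : ∀ i → pos (pointAt i) ≡ i
  pos-pointAt = Inverse.strictlyInverseˡ position

dual : ∀ {n} → PathLayout n → PathLayout n
dual L = record
  { Vertex = Edge ; Edge = Vertex ; vertexOf = edgeOf ; edgeOf = vertexOf
  ; position = inverse (⊎-comm Edge Vertex) position
  ; ends = Joins-comm ∘ ends }
  where open PathLayout L

module _ {a ℓa b ℓb p} (G : SetSys a ℓa b ℓb p) {n : ℕ} (L : PathLayout n) where
  open PathLayout L
  private
    module VG = Setoid (V G)
    module EG = Setoid (E G)
    Q = Υ (D⃗ G)

  pointValue : IHom incHyp Q → Vertex ⊎ Edge → Setoid.Carrier (V G)
  pointValue k = [ app (fV k) , app (fE k) ]′

  pointValue-pos : ∀ k s → pointValue k (pointAt (pos s)) VG.≈ pointValue k s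
  pointValue-pos k s = VG.reflexive (≡.cong (pointValue k) (pointAt-pos s))

  walk : IHom incHyp Q → SHom (P n) G
  walk k = record
    { hV  = discreteFunc (pointValue k ∘ pointAt)
    ; hE  = discreteFunc (proj₁ ∘ app (fI k))
    ; hom = λ j w → ⇔-trans (proj₂ (proj₂ (proj₂ (app (fI k) j))) w)
                      (⇔-trans (pair-cong (V G) (ends≈ (inj₁ (vertexOf j)) (IHom.ς-comm k j))
                                                (ends≈ (inj₂ (edgeOf j)) (IHom.ω-comm k j)) w)
                               (Joins⇒pair≐image {S = V G} (discreteFunc (pointValue k ∘ pointAt)) (ends j) w)) }
    where
    ends≈ : ∀ s {t} → pointValue k s VG.≈ t → t VG.≈ pointValue k (pointAt (pos s))
    ends≈ s e = VG.sym (VG.trans (pointValue-pos k s) e)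

  unwalk : SHom (P n) G → IHom incHyp Q
  unwalk φ = record
    { fV = discreteFunc (app (hV φ) ∘ pos ∘ inj₁)
    ; fE = discreteFunc (app (hV φ) ∘ pos ∘ inj₂)
    ; fI = discreteFunc λ j → app (hE φ) j , _ , _ , λ w →
             ⇔-trans (hom φ j w) (⇔-sym (Joins⇒pair≐image (hV φ) (ends j) w))
    ; ς-comm = λ j → VG.refl
    ; ω-comm = λ j → VG.refl }

  walk↔hom : Inverse (IHomSetoid incHyp Q) (SHomSetoid (P n) G)
  walk↔hom = mkInverse
    (record { to   = walk
            ; cong = λ {k} {k′} → λ { (v≈ , e≈ , i≈) →
                       pointValue-cong {k} {k′} v≈ e≈ ∘ pointAt , proj₁ ∘ i≈ } })
    (record { to   = unwalk
            ; cong = λ (v≈ , e≈) → v≈ ∘ pos ∘ inj₁ , v≈ ∘ pos ∘ inj₂ , λ j → e≈ j , v≈ _ , v≈ _ })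
    (λ φ → (λ i → VG.reflexive (≡.trans (pointValue-unwalk φ (pointAt i)) (≡.cong (app (hV φ)) (pos-pointAt i))))
         , λ j → EG.refl)
    (λ k → pointValue-pos k ∘ inj₁ , pointValue-pos k ∘ inj₂
         , λ j → EG.refl , VG.trans (pointValue-pos k (inj₁ (vertexOf j))) (IHom.ς-comm k j)
                         , VG.trans (pointValue-pos k (inj₂ (edgeOf j))) (IHom.ω-comm k j))
    where
    pointValue-cong : ∀ {k k′} → (∀ v → app (fV k) v VG.≈ app (fV k′) v)
                    → (∀ e → app (fE k) e VG.≈ app (fE k′) e) → ∀ s → pointValue k s VG.≈ pointValue k′ s
    pointValue-cong v≈ e≈ (inj₁ v) = v≈ v
    pointValue-cong v≈ e≈ (inj₂ e) = e≈ e

    pointValue-unwalk : ∀ φ s → pointValue (unwalk φ) s ≡ app (hV φ) (pos s)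
    pointValue-unwalk φ (inj₁ v) = refl
    pointValue-unwalk φ (inj₂ e) = refl

module _ {a ℓa b ℓb p} (G : SetSys a ℓa b ℓb p) {n : ℕ} (L : PathLayout n) where
  open PathLayout L
  private
    module VG = Setoid (V G)
    module EG = Setoid (E G)
    Q = Υ (D⃗ G)
    K = incHyp
    LapIncidence = IHom (K ■ I◇1) Q

  overVertex : LapIncidence → IHom K Q
  overVertex = app (precomp (ιV K))

  overEdge : LapIncidence → IHom (K #) Q
  overEdge = app (precomp (ιE K))

  rungAt : LapIncidence → Vertex ⊎ Edge → Setoid.Carrier (E G)
  rungAt h (inj₁ v) = proj₁ (app (fI h) (inj₂ (inj₂ (v , tt))))
  rungAt h (inj₂ e) = proj₁ (app (fI h) (inj₂ (inj₁ (e , tt))))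

  rungAt-joins : ∀ h s → ε G (rungAt h s)
               ≐ pair (V G) (pointValue G L (overVertex h) s) (pointValue G (dual L) (overEdge h) (swap s))
  rungAt-joins h (inj₁ v) w =
    ⇔-trans (proj₂ (proj₂ (proj₂ (app (fI h) c))) w)
            (pair-cong (V G) (VG.sym (IHom.ς-comm h c)) (VG.sym (IHom.ω-comm h c)) w)
    where c = inj₂ (inj₂ (v , tt))
  rungAt-joins h (inj₂ e) w =
    ⇔-trans (proj₂ (proj₂ (proj₂ (app (fI h) c))) w)
            (⇔-trans (pair-cong (V G) (VG.sym (IHom.ς-comm h c)) (VG.sym (IHom.ω-comm h c)) w)
                     (pair-comm (V G) _ _ w))
    where c = inj₂ (inj₁ (e , tt))

  toLadder : LapIncidence → Ladder (P n) G
  toLadder h = record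
    { rail₁      = walk G L (overVertex h)
    ; rail₂      = walk G (dual L) (overEdge h)
    ; rung       = discreteFunc (rungAt h ∘ pointAt)
    ; rung-joins = rungAt-joins h ∘ pointAt }

  fromLadder : Ladder (P n) G → LapIncidence
  fromLadder l = record
    { fV = record { to = λ { (inj₁ (v , _)) → x (pos (inj₁ v)) ; (inj₂ (e , _)) → y (pos (inj₂ e)) }
                  ; cong = λ { (PW.inj₁ (refl , refl)) → VG.refl ; (PW.inj₂ (refl , refl)) → VG.refl } }
    ; fE = record { to = λ { (inj₁ (e , _)) → x (pos (inj₂ e)) ; (inj₂ (v , _)) → y (pos (inj₁ v)) }
                  ; cong = λ { (PW.inj₁ (refl , refl)) → VG.refl ; (PW.inj₂ (refl , refl)) → VG.refl } }
    ; fI = record { to = arc ; cong = λ { (PW.inj₁ (PW.inj₁ (refl , refl))) → EG.refl , VG.refl , VG.refl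
                                       ; (PW.inj₁ (PW.inj₂ (refl , refl))) → EG.refl , VG.refl , VG.refl
                                       ; (PW.inj₂ (PW.inj₁ (refl , refl))) → EG.refl , VG.refl , VG.refl
                                       ; (PW.inj₂ (PW.inj₂ (refl , refl))) → EG.refl , VG.refl , VG.refl } }
    ; ς-comm = λ { (inj₁ (inj₁ _)) → VG.refl ; (inj₁ (inj₂ _)) → VG.refl
                 ; (inj₂ (inj₁ _)) → VG.refl ; (inj₂ (inj₂ _)) → VG.refl }
    ; ω-comm = λ { (inj₁ (inj₁ _)) → VG.refl ; (inj₁ (inj₂ _)) → VG.refl
                 ; (inj₂ (inj₁ _)) → VG.refl ; (inj₂ (inj₂ _)) → VG.refl } }
    where
    open Ladder l
    x = app (hV rail₁)
    y = app (hV rail₂)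
    arc : Setoid.Carrier (II (K ■ I◇1)) → Setoid.Carrier (QE (D⃗ G))
    arc (inj₁ (inj₁ (j , _))) = app (fI (unwalk G L rail₁)) j
    arc (inj₁ (inj₂ (j , _))) = app (fI (unwalk G (dual L) rail₂)) j
    arc (inj₂ (inj₁ (e , _))) = app rung i , y i , x i , λ w → ⇔-trans (rung-joins i w) (pair-comm (V G) _ _ w)
      where i = pos (inj₂ e)
    arc (inj₂ (inj₂ (v , _))) = app rung i , x i , y i , rung-joins i
      where i = pos (inj₁ v)

  toLadder-cong : ∀ {h h′} → Setoid._≈_ (IHomSetoid (K ■ I◇1) Q) h h′
                → Setoid._≈_ (LadderSetoid (P n) G) (toLadder h) (toLadder h′)
  toLadder-cong {h} {h′} h≈h′@(_ , _ , i≈) =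
      Inverse.to-cong (walk↔hom G L) {overVertex h} {overVertex h′} (Func.cong (precomp (ιV K)) {h} {h′} h≈h′)
    , Inverse.to-cong (walk↔hom G (dual L)) {overEdge h} {overEdge h′} (Func.cong (precomp (ιE K)) {h} {h′} h≈h′)
    , rungAt-cong ∘ pointAt
    where
    rungAt-cong : ∀ s → rungAt h s EG.≈ rungAt h′ s
    rungAt-cong (inj₁ v) = proj₁ (i≈ (inj₂ (inj₂ (v , tt))))
    rungAt-cong (inj₂ e) = proj₁ (i≈ (inj₂ (inj₁ (e , tt))))

  fromLadder-cong : ∀ {l l′} → Setoid._≈_ (LadderSetoid (P n) G) l l′
                  → Setoid._≈_ (IHomSetoid (K ■ I◇1) Q) (fromLadder l) (fromLadder l′)
  fromLadder-cong {l} {l′} ((x≈ , xE≈) , (y≈ , yE≈) , g≈) = v≈ , e≈ , i≈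
    where
    v≈ : ∀ c → app (fV (fromLadder l)) c VG.≈ app (fV (fromLadder l′)) c
    v≈ (inj₁ (v , _)) = x≈ (pos (inj₁ v))
    v≈ (inj₂ (e , _)) = y≈ (pos (inj₂ e))
    e≈ : ∀ c → app (fE (fromLadder l)) c VG.≈ app (fE (fromLadder l′)) c
    e≈ (inj₁ (e , _)) = x≈ (pos (inj₂ e))
    e≈ (inj₂ (v , _)) = y≈ (pos (inj₁ v))
    i≈ : ∀ c → Setoid._≈_ (QE (D⃗ G)) (app (fI (fromLadder l)) c) (app (fI (fromLadder l′)) c)
    i≈ (inj₁ (inj₁ (j , _))) = xE≈ j , x≈ _ , x≈ _
    i≈ (inj₁ (inj₂ (j , _))) = yE≈ j , y≈ _ , y≈ _
    i≈ (inj₂ (inj₁ (e , _))) = g≈ _ , y≈ _ , x≈ _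
    i≈ (inj₂ (inj₂ (v , _))) = g≈ _ , x≈ _ , y≈ _

  toLadder-fromLadder : ∀ l → Setoid._≈_ (LadderSetoid (P n) G) (toLadder (fromLadder l)) l
  toLadder-fromLadder l =
      Inverse.strictlyInverseˡ (walk↔hom G L) (rail₁ l)
    , Inverse.strictlyInverseˡ (walk↔hom G (dual L)) (rail₂ l)
    , λ i → EG.reflexive (≡.trans (rungAt-fromLadder (pointAt i))
                                  (≡.cong (app (rung l)) (pos-pointAt i)))
    where
    open Ladder
    rungAt-fromLadder : ∀ s → rungAt (fromLadder l) s ≡ app (rung l) (pos s)
    rungAt-fromLadder (inj₁ v) = refl
    rungAt-fromLadder (inj₂ e) = refl

  fromLadder-toLadder : ∀ h → Setoid._≈_ (IHomSetoid (K ■ I◇1) Q) (fromLadder (toLadder h)) h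
  fromLadder-toLadder h = v≈ , e≈ , i≈
    where
    onVertex = Inverse.strictlyInverseʳ (walk↔hom G L) (overVertex h)
    onEdge   = Inverse.strictlyInverseʳ (walk↔hom G (dual L)) (overEdge h)
    rung≈ : ∀ s → rungAt h (pointAt (pos s)) EG.≈ rungAt h s
    rung≈ s = EG.reflexive (≡.cong (rungAt h) (pointAt-pos s))
    v≈ : ∀ c → app (fV (fromLadder (toLadder h))) c VG.≈ app (fV h) c
    v≈ (inj₁ (v , _)) = proj₁ onVertex v
    v≈ (inj₂ (e , _)) = proj₁ onEdge e
    e≈ : ∀ c → app (fE (fromLadder (toLadder h))) c VG.≈ app (fE h) c
    e≈ (inj₁ (e , _)) = proj₁ (proj₂ onVertex) e
    e≈ (inj₂ (v , _)) = proj₁ (proj₂ onEdge) v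
    i≈ : ∀ c → Setoid._≈_ (QE (D⃗ G)) (app (fI (fromLadder (toLadder h))) c) (app (fI h) c)
    i≈ (inj₁ (inj₁ (j , _))) = proj₂ (proj₂ onVertex) j
    i≈ (inj₁ (inj₂ (j , _))) = proj₂ (proj₂ onEdge) j
    i≈ c@(inj₂ (inj₁ (e , _))) = rung≈ (inj₂ e)
                               , VG.trans (pointValue-pos G (dual L) (overEdge h) (inj₁ e)) (IHom.ς-comm h c)
                               , VG.trans (pointValue-pos G L (overVertex h) (inj₂ e)) (IHom.ω-comm h c)
    i≈ c@(inj₂ (inj₂ (v , _))) = rung≈ (inj₁ v)
                               , VG.trans (pointValue-pos G L (overVertex h) (inj₁ v)) (IHom.ς-comm h c)
                               , VG.trans (pointValue-pos G (dual L) (overEdge h) (inj₂ v)) (IHom.ω-comm h c)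

  lapIncidence↔ladder : Inverse (IHomSetoid (K ■ I◇1) Q) (LadderSetoid (P n) G)
  lapIncidence↔ladder = mkInverse (record { to = toLadder ; cong = λ {h} {h′} → toLadder-cong {h} {h′} })
                            (record { to = fromLadder ; cong = λ {l} {l′} → fromLadder-cong {l} {l′} })
                            toLadder-fromLadder fromLadder-toLadder

  lapExp≅ΥD⃗Del-boxExp : IIso (lapExp K Q) (Υ (D⃗ (Del (boxExp (P n) G))))
  lapExp≅ΥD⃗Del-boxExp = record
    { isoV   = walk↔hom G L
    ; isoE   = walk↔hom G (dual L)
    ; isoI   = inverse lapIncidence↔ladder (ladder↔arc (P n) G)
    ; ς-comm = λ h → Setoid.refl (SHomSetoid (P n) G) {walk G L (overVertex h)}
    ; ω-comm = λ h → Setoid.refl (SHomSetoid (P n) G) {walk G (dual L) (overEdge h)} }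

double : ∀ n → Fin (suc ⌊ n /2⌋) → Fin (suc n)
double n             zero    = zero
double (suc (suc n)) (suc k) = suc (suc (double n k))

double+1 : ∀ n → Fin ⌈ n /2⌉ → Fin (suc n)
double+1 (suc n)       zero    = suc zero
double+1 (suc (suc n)) (suc k) = suc (suc (double+1 n k))

halve : ∀ n → Fin (suc n) → Fin (suc ⌊ n /2⌋) ⊎ Fin ⌈ n /2⌉
halve n             zero          = inj₁ zero
halve (suc n)       (suc zero)    = inj₂ zero
halve (suc (suc n)) (suc (suc i)) = Sum.map suc suc (halve n i)

halve-double : ∀ n s → halve n ([ double n , double+1 n ]′ s) ≡ s
halve-double n             (inj₁ zero)    = refl
halve-double (suc (suc n)) (inj₁ (suc k)) = ≡.cong (Sum.map suc suc) (halve-double n (inj₁ k))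
halve-double (suc n)       (inj₂ zero)    = refl
halve-double (suc (suc n)) (inj₂ (suc k)) = ≡.cong (Sum.map suc suc) (halve-double n (inj₂ k))

double-halve : ∀ n i → [ double n , double+1 n ]′ (halve n i) ≡ i
double-halve n             zero          = refl
double-halve (suc n)       (suc zero)    = refl
double-halve (suc (suc n)) (suc (suc i)) =
  ≡.trans (double-suc (halve n i)) (≡.cong (λ i → suc (suc i)) (double-halve n i))
  where
  double-suc : ∀ s → [ double (suc (suc n)) , double+1 (suc (suc n)) ]′ (Sum.map suc suc s)
                   ≡ suc (suc ([ double n , double+1 n ]′ s))
  double-suc (inj₁ k) = refl
  double-suc (inj₂ k) = refl

P̌-ends : ∀ n (j : Fin n) → Joins j (double n (app (ς (P̌ n)) j)) (double+1 n (app (ω (P̌ n)) j))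
P̌-ends (suc n)       zero          = inj₁ (refl , refl)
P̌-ends (suc (suc n)) (suc zero)    = inj₂ (refl , refl)
P̌-ends (suc (suc n)) (suc (suc j)) = Joins-suc-suc (P̌-ends n j)

P̌-layout : ∀ n → PathLayout n
P̌-layout n = record
  { Vertex   = Fin (suc ⌊ n /2⌋)
  ; Edge     = Fin ⌈ n /2⌉
  ; vertexOf = app (ς (P̌ n))
  ; edgeOf   = app (ω (P̌ n))
  ; position = mk↔ₛ′ [ double n , double+1 n ]′ (halve n) (double-halve n) (halve-double n)
  ; ends     = P̌-ends n }

-- The isomorphism holds for every set-system hypergraph G.
mainTheorem10 : ∀ {a ℓa b ℓb p} (G : SetSys a ℓa b ℓb p) → IsMultigraph G → (n : ℕ)
              → IIso (lapExp (P̌ n) (Υ (D⃗ G))) (Υ (D⃗ (Del (boxExp (P n) G))))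
mainTheorem10 G _ n = lapExp≅ΥD⃗Del-boxExp G (P̌-layout n)
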